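{- Let $n,t\ge1$ be integers, let $\zeta$ be an $n$th root of unity, and let $\nu\ge0$ be an integer. (1) If $N\ge(\nu+1)n-1$, then \[ \Big(q\tfrac{d}{dq}\Big)^{\nu}F(q)\Big|_{q=\zeta}=\Big(q\tfrac{d}{dq}\Big)^{\nu}F(q;(\nu+1)n-1)\Big|_{q=\zeta}=\Big(q\tfrac{d}{dq}\Big)^{\nu}F(q;N)\Big|_{q=\zeta}. \] (2) If $N\ge(\nu+1)nt-1$, then for all $0\le i\le t-1$, \[ A_t^{(\nu)}(N,i,\zeta)=A_t^{(\nu)}\big((\nu+1)nt-1,i,\zeta\big), \] where $A_t^{(\nu)}$ denotes the $\nu$th derivative with respect to $q$.
   Context: Let $(q)_n=(1-q)(1-q^2)\cdots(1-q^n)$, $(q)_0=1$, and $F(q;N)=\sum_{n=0}^N (q)_n$. The polynomials $A_t(N,i,q)\in\mathbb{Z}[q]$, $0\le i\le t-1$, are defined by $F(q;N)=\sum_{i=0}^{t-1}q^iA_t(N,i,q^t)$. The Kontsevich–Zagier strange function is $F(q)=\sum_{n\ge0}(q)_n$; for a root of unity $\zeta$ the expression $F(\zeta e^{ -z})=\sum_{n\ge0}(\zeta e^{ -z};\zeta e^{ -z})_n$ (with $(x)_n=\prod_{j=1}^n(1-x^j)$) converges as a formal power series in $z$, say $F(\zeta e^{ -z})=\sum_{k\ge0}b_k(\zeta)z^k/k!$, and $\big(q\tfrac{d}{dq}\big)^{\nu}F(q)\big|_{q=\zeta}$ denotes the corresponding value $(-1)^\nu b_\nu(\zeta)$ (since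 $q\,d/dq=-d/dz$ under $q=\zeta e^{ -z}$). -}

module Defs where

open import Level using (Level)
open import Data.Nat as ℕ using (ℕ; zero; suc; _∸_)
open import Data.Integer as ℤ using (ℤ; +_; -[1+_])
open import Data.List using (List; []; _∷_; map; length; replicate; _++_; upTo)
open import Data.Product using (Σ; _×_)
open import Algebra.Bundles using (CommutativeRing)

-- Polynomials in ℤ[q], as coefficient lists (constant term first).

Poly : Set
Poly = List ℤ

infixl 6 _+ₚ_
infixl 7 _*ₚ_

_+ₚ_ : Poly → Poly → Poly
[]       +ₚ q        = q
(a ∷ p)  +ₚ []       = a ∷ p
(a ∷ p)  +ₚ (b ∷ q)  = (a ℤ.+ b) ∷ (p +ₚ q)

_*ₚ_ : Poly → Poly → Poly
[]      *ₚ q = []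
(a ∷ p) *ₚ q = map (a ℤ.*_) q +ₚ (+ 0 ∷ (p *ₚ q))

coeff : Poly → ℕ → ℤ
coeff []      k       = + 0
coeff (a ∷ p) zero    = a
coeff (a ∷ p) (suc k) = coeff p k

oneMinusQPow : ℕ → Poly
oneMinusQPow zero    = + 0 ∷ []
oneMinusQPow (suc j) = + 1 ∷ (replicate j (+ 0) ++ (ℤ.- (+ 1) ∷ []))

qPoch : ℕ → Poly
qPoch zero    = + 1 ∷ []
qPoch (suc n) = qPoch n *ₚ oneMinusQPow (suc n)

Fpoly : ℕ → Poly
Fpoly zero    = qPoch zero
Fpoly (suc N) = Fpoly N +ₚ qPoch (suc N)

-- A_t(N,i,q): the coefficient of q^j in A_t(N,i,q) is the coefficient
-- of q^(i + t j) in F(q;N)   (so F(q;N) = Σ_{i<t} q^i A_t(N,i,q^t)).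
Apoly : ℕ → ℕ → ℕ → Poly
Apoly t N i = map (λ j → coeff (Fpoly N) (i ℕ.+ t ℕ.* j)) (upTo (length (Fpoly N)))

fall : ℕ → ℕ → ℕ
fall k zero    = 1
fall k (suc ν) = (k ∸ ν) ℕ.* fall k ν

module _ {c ℓ : Level} (R : CommutativeRing c ℓ) where
  open CommutativeRing R

  natR : ℕ → Carrier
  natR zero    = 0#
  natR (suc n) = 1# + natR n

  intR : ℤ → Carrier
  intR (+ n)      = natR n
  intR -[1+ n ]   = - natR (suc n)

  powR : Carrier → ℕ → Carrier
  powR x zero    = 1#
  powR x (suc n) = x * powR x n

  sumCoeffs : (ℕ → ℤ → Carrier) → ℕ → Poly → Carrier
  sumCoeffs f k []      = 0#
  sumCoeffs f k (a ∷ p) = f k a + sumCoeffs f (suc k) p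

  -- (q d/dq)^ν P(q) |_{q=ζ} = Σ_k a_k k^ν ζ^k
  qdqEval : ℕ → Carrier → Poly → Carrier
  qdqEval ν ζ P = sumCoeffs (λ k a → intR a * natR (k ℕ.^ ν) * powR ζ k) 0 P

  -- (d/dq)^ν P(q) |_{q=ζ} = Σ_k a_k k(k-1)...(k-ν+1) ζ^(k-ν)
  derivEval : ℕ → Carrier → Poly → Carrier
  derivEval ν ζ P = sumCoeffs (λ k a → intR a * natR (fall k ν) * powR ζ (k ∸ ν)) 0 P

  -- Coefficients of P(ζ e^{-z}) as an exponential (Hurwitz) series in z:
  -- P(ζ e^{-z}) = Σ_j (Σ_k a_k ζ^k (-k)^j) z^j / j!
  hurwitzCoeff : Carrier → Poly → ℕ → Carrier
  hurwitzCoeff ζ P j = sumCoeffs (λ k a → intR a * powR ζ k * intR ((ℤ.- (+ k)) ℤ.^ j)) 0 P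

  -- b_k(ζ) of F(ζ e^{-z}) = Σ_{m≥0} (ζ e^{-z})_m: the (z-adic) limit of the
  -- coefficients of the partial sums Σ_{m≤N} (ζ e^{-z})_m, i.e. the value
  -- they are eventually equal to.
  IsStrangeCoeff : Carrier → ℕ → Carrier → Set ℓ
  IsStrangeCoeff ζ k b = Σ ℕ λ M → (N : ℕ) → M ℕ.≤ N → hurwitzCoeff ζ (Fpoly N) k ≈ b

  -- v = (q d/dq)^ν F(q) |_{q=ζ}, defined as (-1)^ν b_ν(ζ)
  IsStrangeQdq : Carrier → ℕ → Carrier → Set ℓ
  IsStrangeQdq ζ ν v = IsStrangeCoeff ζ ν (powR (- 1#) ν * v)

-- Say that ζ is a zero of order ≥ a of P when P, P′, …, P⁽ᵃ⁻¹⁾ all vanish at ζ.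
-- This survives multiplication by any 1 − q^m, and by the Leibniz rule it improves by
-- one under multiplication by 1 − q^s when ζ^s = 1. Since (q)_m has a factor 1 − q^(kn)
-- for every kn ≤ m, ζ is a zero of order ≥ ν + 1 of (q)_m once m ≥ (ν + 1)n; then the
-- first ν derivatives of (q)_m, and its images under (q d/dq)^j for j ≤ ν, vanish at ζ.
-- Hence these values of F(q;N) at ζ do not change for N ≥ (ν + 1)n − 1, and as b_ν(ζ) is
-- (−1)^ν times the value of (q d/dq)^ν, the strange function takes the same value.
-- For A_t: multiplying by q permutes the t-dissection components cyclically, and the
-- i-th component of P(1 − q^(tkn)) is that of P times 1 − Q^(kn) with Q = q^t, so the
-- same argument runs on every component with n replaced by nt.

module Submission where

open import Defs
open import Level using (Level)
open import Function using (_∘_; id)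
open import Data.Nat as ℕ using (ℕ; zero; suc; _∸_; _≤_; _<_; z≤n; s≤s; NonZero)
import Data.Nat.Properties as ℕₚ
open import Data.Nat.Tactic.RingSolver using (solve-∀)
open import Data.Integer as ℤ using (ℤ; +_; -[1+_]; -1ℤ)
import Data.Integer.Properties as ℤₚ
open import Data.Sign as Sign using ()
open import Data.List using ([]; _∷_; map; length; replicate; _++_; upTo; applyUpTo)
import Data.List.Properties as List
open import Data.Sum using (inj₁; inj₂)
open import Data.Unit.Polymorphic using (⊤; tt)
open import Relation.Nullary using (yes; no)
open import Relation.Binary.Bundles using (Setoid)
import Relation.Binary.Reasoning.Setoid as SetoidReasoning
import Relation.Binary.PropositionalEquality as ≡
import Algebra.Properties.CommutativeSemigroup
open import Algebra.Bundles using (CommutativeRing; Monoid)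

module Polynomials where

  open import Data.Nat using (_+_; _*_)
  open import Data.Product using (_,_)
  open import Relation.Binary.PropositionalEquality

  infix 4 _≋_

  -- A record rather than a function type, so that P and Q can be inferred from a proof.
  record _≋_ (P Q : Poly) : Set where
    constructor coeffwise
    field coeff-≡ : ∀ k → coeff P k ≡ coeff Q k
  open _≋_ public

  ≋-setoid : Setoid _ _
  ≋-setoid = record
    { Carrier       = Poly
    ; _≈_           = _≋_
    ; isEquivalence = record
      { refl  = coeffwise λ k → refl
      ; sym   = λ e → coeffwise λ k → sym (coeff-≡ e k)
      ; trans = λ e f → coeffwise λ k → trans (coeff-≡ e k) (coeff-≡ f k)
      }
    }

  open Setoid ≋-setoid public
    using () renaming (refl to ≋-refl; sym to ≋-sym; trans to ≋-trans; reflexive to ≋-reflexive)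

  module ≋-Reasoning = SetoidReasoning ≋-setoid

  shift : Poly → Poly
  shift P = + 0 ∷ P

  shiftBy : ℕ → Poly → Poly
  shiftBy zero    P = P
  shiftBy (suc s) P = shift (shiftBy s P)

  scale : ℤ → Poly → Poly
  scale c = map (c ℤ.*_)

  weightFrom : ℕ → Poly → Poly
  weightFrom m []      = []
  weightFrom m (a ∷ P) = + m ℤ.* a ∷ weightFrom (suc m) P

  deriv : Poly → Poly
  deriv []      = []
  deriv (a ∷ P) = weightFrom 1 P

  euler : Poly → Poly
  euler = weightFrom 0

  dissect : ℕ → ℕ → Poly → Poly
  dissect t i P = map (λ j → coeff P (i + t * j)) (upTo (length P))

  coeff-+ₚ : ∀ P Q k → coeff (P +ₚ Q) k ≡ coeff P k ℤ.+ coeff Q k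
  coeff-+ₚ []      Q       k       = sym (ℤₚ.+-identityˡ _)
  coeff-+ₚ (a ∷ P) []      k       = sym (ℤₚ.+-identityʳ _)
  coeff-+ₚ (a ∷ P) (b ∷ Q) zero    = refl
  coeff-+ₚ (a ∷ P) (b ∷ Q) (suc k) = coeff-+ₚ P Q k

  coeff-scale : ∀ c P k → coeff (scale c P) k ≡ c ℤ.* coeff P k
  coeff-scale c []      k       = sym (ℤₚ.*-zeroʳ c)
  coeff-scale c (a ∷ P) zero    = refl
  coeff-scale c (a ∷ P) (suc k) = coeff-scale c P k

  coeff-weightFrom : ∀ m P k → coeff (weightFrom m P) k ≡ + (m + k) ℤ.* coeff P k
  coeff-weightFrom m []      k       = sym (ℤₚ.*-zeroʳ (+ (m + k)))
  coeff-weightFrom m (a ∷ P) zero    = cong (λ m′ → + m′ ℤ.* a) (sym (ℕₚ.+-identityʳ m))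
  coeff-weightFrom m (a ∷ P) (suc k) =
    trans (coeff-weightFrom (suc m) P k) (cong (λ m′ → + m′ ℤ.* coeff P k) (sym (ℕₚ.+-suc m k)))

  coeff-deriv : ∀ P k → coeff (deriv P) k ≡ + suc k ℤ.* coeff P (suc k)
  coeff-deriv []      k = sym (ℤₚ.*-zeroʳ (+ suc k))
  coeff-deriv (a ∷ P) k = coeff-weightFrom 1 P k

  coeff-shiftBy-+ : ∀ s P k → coeff (shiftBy s P) (s + k) ≡ coeff P k
  coeff-shiftBy-+ zero    P k = refl
  coeff-shiftBy-+ (suc s) P k = coeff-shiftBy-+ s P k

  coeff-shiftBy-< : ∀ s P k → k < s → coeff (shiftBy s P) k ≡ + 0
  coeff-shiftBy-< (suc s) P zero    _         = refl
  coeff-shiftBy-< (suc s) P (suc k) (s≤s k<s) = coeff-shiftBy-< s P k k<s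

  coeff-≥-length : ∀ P k → length P ≤ k → coeff P k ≡ + 0
  coeff-≥-length []      k       _         = refl
  coeff-≥-length (a ∷ P) (suc k) (s≤s len≤k) = coeff-≥-length P k len≤k

  coeff-map-applyUpTo : ∀ (f : ℕ → ℤ) g {L j} → j < L → coeff (map f (applyUpTo g L)) j ≡ f (g j)
  coeff-map-applyUpTo f g {suc L} {zero}  _         = refl
  coeff-map-applyUpTo f g {suc L} {suc j} (s≤s j<L) = coeff-map-applyUpTo f (g ∘ suc) j<L

  coeff-dissect : ∀ t .{{_ : NonZero t}} i P j → coeff (dissect t i P) j ≡ coeff P (i + t * j)
  coeff-dissect t i P j with j ℕ.<? length P
  ... | yes j<len = coeff-map-applyUpTo (λ j → coeff P (i + t * j)) id j<len
  ... | no  j≮len = trans (coeff-≥-length (dissect t i P) j len′≤j) (sym (coeff-≥-length P (i + t * j) len≤i+tj))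
    where
    len≤j : length P ≤ j
    len≤j = ℕₚ.≮⇒≥ j≮len
    len′≤j : length (dissect t i P) ≤ j
    len′≤j = subst (_≤ j) (sym (trans (List.length-map _ (upTo (length P))) (List.length-upTo (length P)))) len≤j
    len≤i+tj : length P ≤ i + t * j
    len≤i+tj = ℕₚ.≤-trans len≤j (ℕₚ.≤-trans (ℕₚ.m≤n*m j t) (ℕₚ.m≤n+m (t * j) i))

  +ₚ-cong : ∀ {P P′ Q Q′} → P ≋ P′ → Q ≋ Q′ → P +ₚ Q ≋ P′ +ₚ Q′
  +ₚ-cong {P} {P′} {Q} {Q′} e f = coeffwise λ k → begin
    coeff (P +ₚ Q) k              ≡⟨ coeff-+ₚ P Q k ⟩
    coeff P k ℤ.+ coeff Q k       ≡⟨ cong₂ ℤ._+_ (coeff-≡ e k) (coeff-≡ f k) ⟩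
    coeff P′ k ℤ.+ coeff Q′ k     ≡⟨ coeff-+ₚ P′ Q′ k ⟨
    coeff (P′ +ₚ Q′) k            ∎
    where open ≡-Reasoning

  +ₚ-assoc : ∀ P Q R → (P +ₚ Q) +ₚ R ≋ P +ₚ (Q +ₚ R)
  +ₚ-assoc P Q R = coeffwise λ k → begin
    coeff ((P +ₚ Q) +ₚ R) k                  ≡⟨ coeff-+ₚ (P +ₚ Q) R k ⟩
    coeff (P +ₚ Q) k ℤ.+ coeff R k           ≡⟨ cong (ℤ._+ coeff R k) (coeff-+ₚ P Q k) ⟩
    (coeff P k ℤ.+ coeff Q k) ℤ.+ coeff R k  ≡⟨ ℤₚ.+-assoc (coeff P k) _ _ ⟩
    coeff P k ℤ.+ (coeff Q k ℤ.+ coeff R k)  ≡⟨ cong (λ u → coeff P k ℤ.+ u) (coeff-+ₚ Q R k) ⟨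
    coeff P k ℤ.+ coeff (Q +ₚ R) k           ≡⟨ coeff-+ₚ P (Q +ₚ R) k ⟨
    coeff (P +ₚ (Q +ₚ R)) k                  ∎
    where open ≡-Reasoning

  shift-cong : ∀ {P Q} → P ≋ Q → shift P ≋ shift Q
  shift-cong e = coeffwise λ where
    zero    → refl
    (suc k) → coeff-≡ e k

  shiftBy-cong : ∀ s {P Q} → P ≋ Q → shiftBy s P ≋ shiftBy s Q
  shiftBy-cong zero    e = e
  shiftBy-cong (suc s) e = shift-cong (shiftBy-cong s e)

  deriv-cong : ∀ {P Q} → P ≋ Q → deriv P ≋ deriv Q
  deriv-cong {P} {Q} e = coeffwise λ k →
    trans (coeff-deriv P k) (trans (cong (+ suc k ℤ.*_) (coeff-≡ e (suc k))) (sym (coeff-deriv Q k)))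

  deriv-+ₚ : ∀ P Q → deriv (P +ₚ Q) ≋ deriv P +ₚ deriv Q
  deriv-+ₚ P Q = coeffwise λ k → begin
    coeff (deriv (P +ₚ Q)) k                                  ≡⟨ coeff-deriv (P +ₚ Q) k ⟩
    + suc k ℤ.* coeff (P +ₚ Q) (suc k)                        ≡⟨ cong (+ suc k ℤ.*_) (coeff-+ₚ P Q (suc k)) ⟩
    + suc k ℤ.* (coeff P (suc k) ℤ.+ coeff Q (suc k))         ≡⟨ ℤₚ.*-distribˡ-+ (+ suc k) (coeff P (suc k)) (coeff Q (suc k)) ⟩
    + suc k ℤ.* coeff P (suc k) ℤ.+ + suc k ℤ.* coeff Q (suc k) ≡⟨ cong₂ ℤ._+_ (coeff-deriv P k) (coeff-deriv Q k) ⟨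
    coeff (deriv P) k ℤ.+ coeff (deriv Q) k                   ≡⟨ coeff-+ₚ (deriv P) (deriv Q) k ⟨
    coeff (deriv P +ₚ deriv Q) k                              ∎
    where open ≡-Reasoning

  deriv-scale : ∀ c P → deriv (scale c P) ≋ scale c (deriv P)
  deriv-scale c P = coeffwise λ k → begin
    coeff (deriv (scale c P)) k              ≡⟨ coeff-deriv (scale c P) k ⟩
    + suc k ℤ.* coeff (scale c P) (suc k)    ≡⟨ cong (+ suc k ℤ.*_) (coeff-scale c P (suc k)) ⟩
    + suc k ℤ.* (c ℤ.* coeff P (suc k))      ≡⟨ ℤₚ.*-assoc (+ suc k) c _ ⟨
    + suc k ℤ.* c ℤ.* coeff P (suc k)        ≡⟨ cong (ℤ._* coeff P (suc k)) (ℤₚ.*-comm (+ suc k) c) ⟩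
    c ℤ.* + suc k ℤ.* coeff P (suc k)        ≡⟨ ℤₚ.*-assoc c (+ suc k) _ ⟩
    c ℤ.* (+ suc k ℤ.* coeff P (suc k))      ≡⟨ cong (c ℤ.*_) (coeff-deriv P k) ⟨
    c ℤ.* coeff (deriv P) k                  ≡⟨ coeff-scale c (deriv P) k ⟨
    coeff (scale c (deriv P)) k              ∎
    where open ≡-Reasoning

  deriv-shift : ∀ P → deriv (shift P) ≋ P +ₚ shift (deriv P)
  deriv-shift P = coeffwise λ where
    zero    → trans (coeff-deriv (shift P) 0)
                    (trans (ℤₚ.*-identityˡ _) (trans (sym (ℤₚ.+-identityʳ _)) (sym (coeff-+ₚ P (shift (deriv P)) 0))))
    (suc k) → trans (coeff-deriv (shift P) (suc k))
                    (trans (ℤₚ.suc-* (+ suc k) (coeff P (suc k)))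
                      (trans (cong (λ u → coeff P (suc k) ℤ.+ u) (sym (coeff-deriv P k)))
                        (sym (coeff-+ₚ P (shift (deriv P)) (suc k)))))

  euler≋shift∘deriv : ∀ P → euler P ≋ shift (deriv P)
  euler≋shift∘deriv P = coeffwise λ where
    zero    → trans (coeff-weightFrom 0 P 0) (ℤₚ.*-zeroˡ (coeff P 0))
    (suc k) → trans (coeff-weightFrom 0 P (suc k)) (sym (coeff-deriv P k))

  coeff-shiftBy-deriv : ∀ j X m → coeff (shiftBy (suc j) (deriv X)) (j + m) ≡ + m ℤ.* coeff X m
  coeff-shiftBy-deriv j X zero =
    trans (coeff-shiftBy-< (suc j) (deriv X) (j + 0) (s≤s (ℕₚ.≤-reflexive (ℕₚ.+-identityʳ j))))
          (sym (ℤₚ.*-zeroˡ (coeff X 0)))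
  coeff-shiftBy-deriv j X (suc m) =
    trans (cong (coeff (shiftBy (suc j) (deriv X))) (ℕₚ.+-suc j m))
          (trans (coeff-shiftBy-+ (suc j) (deriv X) m) (coeff-deriv X m))

  deriv-shiftBy : ∀ j X → deriv (shiftBy (suc j) X) ≋ shiftBy (suc j) (deriv X) +ₚ scale (+ suc j) (shiftBy j X)
  deriv-shiftBy j X = coeffwise λ k → trans (coeff-deriv (shiftBy (suc j) X) k)
    (sym (trans (coeff-+ₚ (shiftBy (suc j) (deriv X)) (scale (+ suc j) (shiftBy j X)) k) (coeffs k)))
    where
    open ≡-Reasoning
    coeffs : ∀ k → coeff (shiftBy (suc j) (deriv X)) k ℤ.+ coeff (scale (+ suc j) (shiftBy j X)) k
             ≡ + suc k ℤ.* coeff (shiftBy (suc j) X) (suc k)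
    coeffs k with k ℕ.<? j
    ... | yes k<j = begin
      coeff (shiftBy (suc j) (deriv X)) k ℤ.+ coeff (scale (+ suc j) (shiftBy j X)) k
        ≡⟨ cong₂ ℤ._+_ (coeff-shiftBy-< (suc j) (deriv X) k (ℕₚ.m<n⇒m<1+n k<j)) (coeff-scale (+ suc j) (shiftBy j X) k) ⟩
      + 0 ℤ.+ + suc j ℤ.* coeff (shiftBy j X) k
        ≡⟨ cong (λ u → + 0 ℤ.+ + suc j ℤ.* u) (coeff-shiftBy-< j X k k<j) ⟩
      + 0 ℤ.+ + suc j ℤ.* + 0
        ≡⟨ cong (λ u → + 0 ℤ.+ u) (ℤₚ.*-zeroʳ (+ suc j)) ⟩
      + 0
        ≡⟨ ℤₚ.*-zeroʳ (+ suc k) ⟨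
      + suc k ℤ.* + 0
        ≡⟨ cong (+ suc k ℤ.*_) (coeff-shiftBy-< j X k k<j) ⟨
      + suc k ℤ.* coeff (shiftBy (suc j) X) (suc k) ∎
    ... | no k≮j with ℕₚ.m≤n⇒∃[o]m+o≡n (ℕₚ.≮⇒≥ k≮j)
    ...   | m , refl = begin
      coeff (shiftBy (suc j) (deriv X)) (j + m) ℤ.+ coeff (scale (+ suc j) (shiftBy j X)) (j + m)
        ≡⟨ cong₂ ℤ._+_ (coeff-shiftBy-deriv j X m) (coeff-scale (+ suc j) (shiftBy j X) (j + m)) ⟩
      + m ℤ.* coeff X m ℤ.+ + suc j ℤ.* coeff (shiftBy j X) (j + m)
        ≡⟨ cong (λ u → + m ℤ.* coeff X m ℤ.+ + suc j ℤ.* u) (coeff-shiftBy-+ j X m) ⟩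
      + m ℤ.* coeff X m ℤ.+ + suc j ℤ.* coeff X m
        ≡⟨ ℤₚ.*-distribʳ-+ (coeff X m) (+ m) (+ suc j) ⟨
      (+ m ℤ.+ + suc j) ℤ.* coeff X m
        ≡⟨ cong (λ u → + u ℤ.* coeff X m) (ℕₚ.+-comm m (suc j)) ⟩
      + suc (j + m) ℤ.* coeff X m
        ≡⟨ cong (+ suc (j + m) ℤ.*_) (coeff-shiftBy-+ (suc j) X m) ⟨
      + suc (j + m) ℤ.* coeff (shiftBy (suc j) X) (suc (j + m)) ∎

  deriv-+-shiftBy-scale : ∀ j c P → deriv (P +ₚ shiftBy (suc j) (scale c P))
                          ≋ (deriv P +ₚ shiftBy (suc j) (scale c (deriv P))) +ₚ scale (+ suc j) (shiftBy j (scale c P))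
  deriv-+-shiftBy-scale j c P = begin
    deriv (P +ₚ shiftBy s (scale c P))
      ≈⟨ deriv-+ₚ P _ ⟩
    deriv P +ₚ deriv (shiftBy s (scale c P))
      ≈⟨ +ₚ-cong (≋-refl {deriv P}) (deriv-shiftBy j (scale c P)) ⟩
    deriv P +ₚ (shiftBy s (deriv (scale c P)) +ₚ scale (+ s) (shiftBy j (scale c P)))
      ≈⟨ +ₚ-cong (≋-refl {deriv P})
                 (+ₚ-cong (shiftBy-cong s (deriv-scale c P)) (≋-refl {scale (+ s) (shiftBy j (scale c P))})) ⟩
    deriv P +ₚ (shiftBy s (scale c (deriv P)) +ₚ scale (+ s) (shiftBy j (scale c P)))
      ≈⟨ +ₚ-assoc (deriv P) (shiftBy s (scale c (deriv P))) (scale (+ s) (shiftBy j (scale c P))) ⟨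
    (deriv P +ₚ shiftBy s (scale c (deriv P))) +ₚ scale (+ s) (shiftBy j (scale c P)) ∎
    where
    s = suc j
    open ≋-Reasoning

  *ₚ-[] : ∀ P → P *ₚ [] ≋ []
  *ₚ-[] P = coeffwise (go P)
    where
    go : ∀ P k → coeff (P *ₚ []) k ≡ + 0
    go []      k       = refl
    go (a ∷ P) zero    = refl
    go (a ∷ P) (suc k) = go P k

  *ₚ-∷ : ∀ P b B → P *ₚ (b ∷ B) ≋ scale b P +ₚ shift (P *ₚ B)
  *ₚ-∷ P b B = coeffwise (go P)
    where
    go : ∀ P k → coeff (P *ₚ (b ∷ B)) k ≡ coeff (scale b P +ₚ shift (P *ₚ B)) k
    go []      zero    = refl
    go []      (suc k) = refl
    go (a ∷ P) zero    = cong (ℤ._+ + 0) (ℤₚ.*-comm a b)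
    go (a ∷ P) (suc k) = begin
      coeff (scale a (b ∷ B) +ₚ shift (P *ₚ (b ∷ B))) (suc k)
        ≡⟨ coeff-+ₚ (scale a B) (P *ₚ (b ∷ B)) k ⟩
      coeff (scale a B) k ℤ.+ coeff (P *ₚ (b ∷ B)) k
        ≡⟨ cong (λ u → coeff (scale a B) k ℤ.+ u) (trans (go P k) (coeff-+ₚ (scale b P) (shift (P *ₚ B)) k)) ⟩
      coeff (scale a B) k ℤ.+ (coeff (scale b P) k ℤ.+ coeff (shift (P *ₚ B)) k)
        ≡⟨ ℤₚ.+-assoc (coeff (scale a B) k) _ _ ⟨
      coeff (scale a B) k ℤ.+ coeff (scale b P) k ℤ.+ coeff (shift (P *ₚ B)) k
        ≡⟨ cong (ℤ._+ coeff (shift (P *ₚ B)) k) (ℤₚ.+-comm (coeff (scale a B) k) _) ⟩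
      coeff (scale b P) k ℤ.+ coeff (scale a B) k ℤ.+ coeff (shift (P *ₚ B)) k
        ≡⟨ ℤₚ.+-assoc (coeff (scale b P) k) _ _ ⟩
      coeff (scale b P) k ℤ.+ (coeff (scale a B) k ℤ.+ coeff (shift (P *ₚ B)) k)
        ≡⟨ cong (λ u → coeff (scale b P) k ℤ.+ u) (coeff-+ₚ (scale a B) (shift (P *ₚ B)) k) ⟨
      coeff (scale b P) k ℤ.+ coeff ((a ∷ P) *ₚ B) k
        ≡⟨ coeff-+ₚ (scale b P) ((a ∷ P) *ₚ B) k ⟨
      coeff (scale b (a ∷ P) +ₚ shift ((a ∷ P) *ₚ B)) (suc k) ∎
      where open ≡-Reasoning

  scale0-+ₚ : ∀ P X → scale (+ 0) P +ₚ X ≋ X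
  scale0-+ₚ P X = coeffwise λ k → trans (coeff-+ₚ (scale (+ 0) P) X k)
    (trans (cong (ℤ._+ coeff X k) (trans (coeff-scale (+ 0) P k) (ℤₚ.*-zeroˡ (coeff P k)))) (ℤₚ.+-identityˡ _))

  *ₚ-zeros : ∀ P j B → P *ₚ (replicate j (+ 0) ++ B) ≋ shiftBy j (P *ₚ B)
  *ₚ-zeros P zero    B = ≋-refl
  *ₚ-zeros P (suc j) B = ≋-trans (*ₚ-∷ P (+ 0) (replicate j (+ 0) ++ B))
    (≋-trans (scale0-+ₚ P _) (shift-cong (*ₚ-zeros P j B)))

  *ₚ-oneMinusQPow : ∀ P m → P *ₚ oneMinusQPow (suc m) ≋ P +ₚ shiftBy (suc m) (scale -1ℤ P)
  *ₚ-oneMinusQPow P m = ≋-trans (*ₚ-∷ P (+ 1) _)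
    (+ₚ-cong scale-1 (shift-cong (≋-trans (*ₚ-zeros P m (-1ℤ ∷ [])) (shiftBy-cong m times-1))))
    where
    scale-1 : scale (+ 1) P ≋ P
    scale-1 = coeffwise λ k → trans (coeff-scale (+ 1) P k) (ℤₚ.*-identityˡ _)
    times-1 : P *ₚ (-1ℤ ∷ []) ≋ scale -1ℤ P
    times-1 = ≋-trans (*ₚ-∷ P -1ℤ []) (coeffwise λ k → trans (coeff-+ₚ (scale -1ℤ P) (shift (P *ₚ [])) k)
      (trans (cong (λ u → coeff (scale -1ℤ P) k ℤ.+ u) (trans (coeff-≡ (shift-cong (*ₚ-[] P)) k) (shift[] k)))
        (ℤₚ.+-identityʳ _)))
      where
      shift[] : ∀ k → coeff (shift []) k ≡ + 0
      shift[] zero    = refl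
      shift[] (suc k) = refl

  shiftBy-+ : ∀ m n X → shiftBy (m + n) X ≡ shiftBy m (shiftBy n X)
  shiftBy-+ zero    n X = refl
  shiftBy-+ (suc m) n X = cong shift (shiftBy-+ m n X)

  i+t[1+j]≡t+[i+tj] : ∀ i t j → i + t * suc j ≡ t + (i + t * j)
  i+t[1+j]≡t+[i+tj] = solve-∀

  module _ (t : ℕ) .{{_ : NonZero t}} where

    dissect-≋ : ∀ i P Q → (∀ j → coeff P (i + t * j) ≡ coeff Q j) → dissect t i P ≋ Q
    dissect-≋ i P Q e = coeffwise λ j → trans (coeff-dissect t i P j) (e j)

    dissect-cong : ∀ i {P Q} → P ≋ Q → dissect t i P ≋ dissect t i Q
    dissect-cong i {P} {Q} e = dissect-≋ i P (dissect t i Q) λ j →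
      trans (coeff-≡ e (i + t * j)) (sym (coeff-dissect t i Q j))

    dissect-+ₚ : ∀ i P Q → dissect t i (P +ₚ Q) ≋ dissect t i P +ₚ dissect t i Q
    dissect-+ₚ i P Q = dissect-≋ i (P +ₚ Q) _ λ j → begin
      coeff (P +ₚ Q) (i + t * j)                       ≡⟨ coeff-+ₚ P Q (i + t * j) ⟩
      coeff P (i + t * j) ℤ.+ coeff Q (i + t * j)      ≡⟨ cong₂ ℤ._+_ (coeff-dissect t i P j) (coeff-dissect t i Q j) ⟨
      coeff (dissect t i P) j ℤ.+ coeff (dissect t i Q) j ≡⟨ coeff-+ₚ (dissect t i P) (dissect t i Q) j ⟨
      coeff (dissect t i P +ₚ dissect t i Q) j         ∎
      where open ≡-Reasoning

    dissect-scale : ∀ i c P → dissect t i (scale c P) ≋ scale c (dissect t i P)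
    dissect-scale i c P = dissect-≋ i (scale c P) _ λ j →
      trans (coeff-scale c P (i + t * j))
        (trans (cong (c ℤ.*_) (sym (coeff-dissect t i P j))) (sym (coeff-scale c (dissect t i P) j)))

    dissect-shift-suc : ∀ i P → dissect t (suc i) (shift P) ≋ dissect t i P
    dissect-shift-suc i P = dissect-≋ (suc i) (shift P) _ λ j → sym (coeff-dissect t i P j)

    dissect-shiftBy-t : ∀ i P → i < t → dissect t i (shiftBy t P) ≋ shift (dissect t i P)
    dissect-shiftBy-t i P i<t = dissect-≋ i (shiftBy t P) _ λ where
      zero    → trans (cong (coeff (shiftBy t P)) (trans (cong (λ u → i + u) (ℕₚ.*-zeroʳ t)) (ℕₚ.+-identityʳ i)))
                  (coeff-shiftBy-< t P i i<t)
      (suc j) → trans (cong (coeff (shiftBy t P)) (i+t[1+j]≡t+[i+tj] i t j))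
                  (trans (coeff-shiftBy-+ t P (i + t * j)) (sym (coeff-dissect t i P j)))

    dissect-shiftBy-multiple : ∀ i P → i < t → ∀ s → dissect t i (shiftBy (t * s) P) ≋ shiftBy s (dissect t i P)
    dissect-shiftBy-multiple i P i<t zero    = ≋-reflexive (cong (λ s → dissect t i (shiftBy s P)) (ℕₚ.*-zeroʳ t))
    dissect-shiftBy-multiple i P i<t (suc s) = begin
      dissect t i (shiftBy (t * suc s) P)
        ≡⟨ cong (dissect t i) (trans (cong (λ u → shiftBy u P) (ℕₚ.*-suc t s)) (shiftBy-+ t (t * s) P)) ⟩
      dissect t i (shiftBy t (shiftBy (t * s) P)) ≈⟨ dissect-shiftBy-t i (shiftBy (t * s) P) i<t ⟩
      shift (dissect t i (shiftBy (t * s) P))   ≈⟨ shift-cong (dissect-shiftBy-multiple i P i<t s) ⟩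
      shiftBy (suc s) (dissect t i P)           ∎
      where open ≋-Reasoning

  dissect-shift-zero : ∀ t P → dissect (suc t) 0 (shift P) ≋ shift (dissect (suc t) t P)
  dissect-shift-zero t P = dissect-≋ (suc t) 0 (shift P) _ λ where
    zero    → cong (coeff (shift P)) (ℕₚ.*-zeroʳ t)
    (suc j) → trans (cong (coeff (shift P)) (ℕₚ.*-suc (suc t) j)) (sym (coeff-dissect (suc t) t P j))

  -- Each factor 1 − q^(k(L+1)) of (q)_m raises the index of Q by one.
  module _ {ℓ} (Q : ℕ → Poly → Set ℓ) (L : ℕ)
    (Q-zero  : ∀ P → Q 0 P)
    (Q-times : ∀ {a} m {P} → Q a P → Q a (P *ₚ oneMinusQPow (suc m)))
    (Q-gain  : ∀ {a} k {P} → Q a P → Q (suc a) (P *ₚ oneMinusQPow (suc k * suc L)))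
    where

    qPoch-accumulates-+ : ∀ a r → Q a (qPoch (a * suc L + r))
    qPoch-accumulates-+ zero    zero    = Q-zero (qPoch 0)
    qPoch-accumulates-+ (suc a) zero    =
      subst (Q (suc a) ∘ qPoch) (sym (ℕₚ.+-identityʳ (suc a * suc L)))
        (subst (λ x → Q (suc a) (qPoch x *ₚ oneMinusQPow (suc a * suc L))) (ℕₚ.+-comm (a * suc L) L)
          (Q-gain a (qPoch-accumulates-+ a L)))
    qPoch-accumulates-+ a       (suc r) =
      subst (Q a ∘ qPoch) (sym (ℕₚ.+-suc (a * suc L) r)) (Q-times (a * suc L + r) (qPoch-accumulates-+ a r))

    qPoch-accumulates : ∀ a m → a * suc L ≤ m → Q a (qPoch m)
    qPoch-accumulates a m aL≤m = subst (Q a ∘ qPoch) (ℕₚ.m+[n∸m]≡n aL≤m) (qPoch-accumulates-+ a (m ℕ.∸ a * suc L))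

  fall-suc : ∀ j ν → fall (suc j) (suc ν) ≡ suc j * fall j ν
  fall-suc j zero    = refl
  fall-suc j (suc ν) = begin
    (j ℕ.∸ ν) * fall (suc j) (suc ν)   ≡⟨ cong ((j ℕ.∸ ν) *_) (fall-suc j ν) ⟩
    (j ℕ.∸ ν) * (suc j * fall j ν)     ≡⟨ ℕₚ.*-assoc (j ℕ.∸ ν) (suc j) (fall j ν) ⟨
    (j ℕ.∸ ν) * suc j * fall j ν       ≡⟨ cong (_* fall j ν) (ℕₚ.*-comm (j ℕ.∸ ν) (suc j)) ⟩
    suc j * (j ℕ.∸ ν) * fall j ν       ≡⟨ ℕₚ.*-assoc (suc j) (j ℕ.∸ ν) (fall j ν) ⟩
    suc j * ((j ℕ.∸ ν) * fall j ν)     ∎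
    where open ≡-Reasoning

open Polynomials

module Evaluation {c ℓ : Level} (R : CommutativeRing c ℓ) where

  open CommutativeRing R
  open import Algebra.Properties.Ring ring using (-1*x≈-x; -‿distribˡ-*; -‿distribʳ-*; -0#≈0#; -‿involutive; -‿+-comm)
  module +-CS = Algebra.Properties.CommutativeSemigroup +-commutativeSemigroup
  module *-CS = Algebra.Properties.CommutativeSemigroup *-commutativeSemigroup
  open import Algebra.Properties.Semiring.Mult semiring using (_×_; ×-homo-+; ×1-homo-*)
  open import Algebra.Properties.Semiring.Exp semiring using (_^_; ^-homo-*)
  open import Relation.Binary.Reasoning.Setoid setoid

  natR≡×1# : ∀ n → natR R n ≡.≡ n × 1#
  natR≡×1# zero    = ≡.refl
  natR≡×1# (suc n) = ≡.cong (λ y → 1# + y) (natR≡×1# n)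

  natR-+ : ∀ m n → natR R (m ℕ.+ n) ≈ natR R m + natR R n
  natR-+ m n rewrite natR≡×1# (m ℕ.+ n) | natR≡×1# m | natR≡×1# n = ×-homo-+ 1# m n

  natR-* : ∀ m n → natR R (m ℕ.* n) ≈ natR R m * natR R n
  natR-* m n rewrite natR≡×1# (m ℕ.* n) | natR≡×1# m | natR≡×1# n = ×1-homo-* m n

  powR≡^ : ∀ x n → powR R x n ≡.≡ x ^ n
  powR≡^ x zero    = ≡.refl
  powR≡^ x (suc n) = ≡.cong (x *_) (powR≡^ x n)

  powR-+ : ∀ x m n → powR R x (m ℕ.+ n) ≈ powR R x m * powR R x n
  powR-+ x m n rewrite powR≡^ x (m ℕ.+ n) | powR≡^ x m | powR≡^ x n = ^-homo-* x m n

  powR-cong : ∀ {x y} → x ≈ y → ∀ n → powR R x n ≈ powR R y n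
  powR-cong x≈y zero    = refl
  powR-cong x≈y (suc n) = *-cong x≈y (powR-cong x≈y n)

  powR-*-1 : ∀ x n → powR R x n ≈ 1# → ∀ k → powR R x (k ℕ.* n) ≈ 1#
  powR-*-1 x n xⁿ≈1 zero    = refl
  powR-*-1 x n xⁿ≈1 (suc k) = begin
    powR R x (n ℕ.+ k ℕ.* n)          ≈⟨ powR-+ x n (k ℕ.* n) ⟩
    powR R x n * powR R x (k ℕ.* n)   ≈⟨ *-cong xⁿ≈1 (powR-*-1 x n xⁿ≈1 k) ⟩
    1# * 1#                           ≈⟨ *-identityˡ 1# ⟩
    1#                                ∎

  powR-neg : ∀ x n → powR R (- x) n ≈ powR R (- 1#) n * powR R x n
  powR-neg x zero    = sym (*-identityˡ 1#)
  powR-neg x (suc n) = begin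
    - x * powR R (- x) n                          ≈⟨ *-cong (sym (-1*x≈-x x)) (powR-neg x n) ⟩
    (- 1# * x) * (powR R (- 1#) n * powR R x n)   ≈⟨ *-CS.interchange (- 1#) x _ _ ⟩
    (- 1# * powR R (- 1#) n) * (x * powR R x n)   ∎

  natR-^ : ∀ k n → natR R (k ℕ.^ n) ≈ powR R (natR R k) n
  natR-^ k zero    = +-identityʳ 1#
  natR-^ k (suc n) = trans (natR-* k (k ℕ.^ n)) (*-cong refl (natR-^ k n))

  1+x-[1+y]≈x-y : ∀ x y → (1# + x) + - (1# + y) ≈ x + - y
  1+x-[1+y]≈x-y x y = begin
    (1# + x) + - (1# + y)      ≈⟨ +-congˡ (sym (-‿+-comm 1# y)) ⟩
    (1# + x) + (- 1# + - y)    ≈⟨ +-CS.interchange 1# x (- 1#) (- y) ⟩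
    (1# + - 1#) + (x + - y)    ≈⟨ +-congʳ (-‿inverseʳ 1#) ⟩
    0# + (x + - y)             ≈⟨ +-identityˡ _ ⟩
    x + - y                    ∎

  intR-⊖ : ∀ m n → intR R (m ℤ.⊖ n) ≈ natR R m + - natR R n
  intR-⊖ zero    zero    = sym (trans (+-identityˡ _) -0#≈0#)
  intR-⊖ zero    (suc n) = sym (+-identityˡ _)
  intR-⊖ (suc m) zero    = sym (trans (+-congˡ -0#≈0#) (+-identityʳ _))
  intR-⊖ (suc m) (suc n) = begin
    intR R (suc m ℤ.⊖ suc n)          ≡⟨ ≡.cong (intR R) (ℤₚ.[1+m]⊖[1+n]≡m⊖n m n) ⟩
    intR R (m ℤ.⊖ n)                  ≈⟨ intR-⊖ m n ⟩
    natR R m + - natR R n             ≈⟨ 1+x-[1+y]≈x-y (natR R m) (natR R n) ⟨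
    natR R (suc m) + - natR R (suc n) ∎

  intR-neg : ∀ a → intR R (ℤ.- a) ≈ - intR R a
  intR-neg (+ zero)  = sym -0#≈0#
  intR-neg (+ suc n) = refl
  intR-neg -[1+ n ]  = sym (-‿involutive _)

  intR-+ : ∀ a b → intR R (a ℤ.+ b) ≈ intR R a + intR R b
  intR-+ (+ m)    (+ n)    = natR-+ m n
  intR-+ (+ m)    -[1+ n ] = intR-⊖ m (suc n)
  intR-+ -[1+ m ] (+ n)    = trans (intR-⊖ n (suc m)) (+-comm _ _)
  intR-+ -[1+ m ] -[1+ n ] = begin
    - (1# + (1# + natR R (m ℕ.+ n)))         ≈⟨ -‿cong (+-congˡ (+-congˡ (natR-+ m n))) ⟩
    - (1# + (1# + (natR R m + natR R n)))    ≈⟨ -‿cong (+-congˡ (+-CS.x∙yz≈y∙xz (natR R m) 1# _)) ⟨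
    - (1# + (natR R m + (1# + natR R n)))    ≈⟨ -‿cong (+-assoc 1# _ _) ⟨
    - ((1# + natR R m) + (1# + natR R n))    ≈⟨ -‿+-comm _ _ ⟨
    - (1# + natR R m) + - (1# + natR R n)    ∎

  intR-+◃ : ∀ k → intR R (Sign.+ ℤ.◃ k) ≈ natR R k
  intR-+◃ zero    = refl
  intR-+◃ (suc k) = refl

  intR--◃ : ∀ k → intR R (Sign.- ℤ.◃ k) ≈ - natR R k
  intR--◃ zero    = sym -0#≈0#
  intR--◃ (suc k) = refl

  intR-* : ∀ a b → intR R (a ℤ.* b) ≈ intR R a * intR R b
  intR-* (+ m)    (+ n)    = trans (intR-+◃ (m ℕ.* n)) (natR-* m n)
  intR-* (+ m)    -[1+ n ] = trans (intR--◃ (m ℕ.* suc n)) (trans (-‿cong (natR-* m (suc n))) (-‿distribʳ-* _ _))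
  intR-* -[1+ m ] (+ n)    = trans (intR--◃ (suc m ℕ.* n)) (trans (-‿cong (natR-* (suc m) n)) (-‿distribˡ-* _ _))
  intR-* -[1+ m ] -[1+ n ] = begin
    intR R (Sign.+ ℤ.◃ (suc m ℕ.* suc n))      ≈⟨ intR-+◃ (suc m ℕ.* suc n) ⟩
    natR R (suc m ℕ.* suc n)                   ≈⟨ natR-* (suc m) (suc n) ⟩
    natR R (suc m) * natR R (suc n)            ≈⟨ -‿involutive _ ⟨
    - - (natR R (suc m) * natR R (suc n))      ≈⟨ -‿cong (-‿distribʳ-* _ _) ⟩
    - (natR R (suc m) * - natR R (suc n))      ≈⟨ -‿distribˡ-* _ _ ⟩
    - natR R (suc m) * - natR R (suc n)        ∎

  intR-^ : ∀ a n → intR R (a ℤ.^ n) ≈ powR R (intR R a) n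
  intR-^ a zero    = +-identityʳ 1#
  intR-^ a (suc n) = trans (intR-* a (a ℤ.^ n)) (*-congˡ (intR-^ a n))

  weightedSum : (ℕ → Carrier) → Poly → Carrier
  weightedSum w []      = 0#
  weightedSum w (a ∷ P) = intR R a * w 0 + weightedSum (w ∘ suc) P

  weightedSum-cong : ∀ {w w′} → (∀ j → w j ≈ w′ j) → ∀ P → weightedSum w P ≈ weightedSum w′ P
  weightedSum-cong w≈w′ []      = refl
  weightedSum-cong w≈w′ (a ∷ P) = +-cong (*-congˡ (w≈w′ 0)) (weightedSum-cong (w≈w′ ∘ suc) P)

  sumCoeffs≈weightedSum : ∀ (f : ℕ → ℤ → Carrier) w → (∀ k a → f k a ≈ intR R a * w k) →
                          ∀ k P → sumCoeffs R f k P ≈ weightedSum (λ j → w (k ℕ.+ j)) P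
  sumCoeffs≈weightedSum f w f≈ k []      = refl
  sumCoeffs≈weightedSum f w f≈ k (a ∷ P) = +-cong
    (trans (f≈ k a) (*-congˡ (reflexive (≡.cong w (≡.sym (ℕₚ.+-identityʳ k))))))
    (trans (sumCoeffs≈weightedSum f w f≈ (suc k) P)
           (weightedSum-cong (λ j → reflexive (≡.cong w (≡.sym (ℕₚ.+-suc k j)))) P))

  weightedSum-+ₚ : ∀ w P Q → weightedSum w (P +ₚ Q) ≈ weightedSum w P + weightedSum w Q
  weightedSum-+ₚ w []      Q       = sym (+-identityˡ _)
  weightedSum-+ₚ w (a ∷ P) []      = sym (+-identityʳ _)
  weightedSum-+ₚ w (a ∷ P) (b ∷ Q) = begin
    intR R (a ℤ.+ b) * w 0 + weightedSum (w ∘ suc) (P +ₚ Q)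
      ≈⟨ +-cong (*-congʳ (intR-+ a b)) (weightedSum-+ₚ (w ∘ suc) P Q) ⟩
    (intR R a + intR R b) * w 0 + (weightedSum (w ∘ suc) P + weightedSum (w ∘ suc) Q)
      ≈⟨ +-congʳ (distribʳ (w 0) (intR R a) (intR R b)) ⟩
    (intR R a * w 0 + intR R b * w 0) + (weightedSum (w ∘ suc) P + weightedSum (w ∘ suc) Q)
      ≈⟨ +-CS.interchange _ _ _ _ ⟩
    (intR R a * w 0 + weightedSum (w ∘ suc) P) + (intR R b * w 0 + weightedSum (w ∘ suc) Q) ∎

  weightedSum-*ˡ : ∀ x w P → weightedSum (λ j → x * w j) P ≈ x * weightedSum w P
  weightedSum-*ˡ x w []      = sym (zeroʳ x)
  weightedSum-*ˡ x w (a ∷ P) =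
    trans (+-cong (*-CS.x∙yz≈y∙xz _ _ _) (weightedSum-*ˡ x (w ∘ suc) P)) (sym (distribˡ x _ _))

  weightedSum-scale : ∀ w c P → weightedSum w (scale c P) ≈ intR R c * weightedSum w P
  weightedSum-scale w c []      = sym (zeroʳ _)
  weightedSum-scale w c (a ∷ P) =
    trans (+-cong (trans (*-congʳ (intR-* c a)) (*-assoc _ _ _)) (weightedSum-scale (w ∘ suc) c P))
          (sym (distribˡ _ _ _))

  weightedSum-zero : ∀ w P → (∀ k → coeff P k ≡.≡ + 0) → weightedSum w P ≈ 0#
  weightedSum-zero w []      P≡0 = refl
  weightedSum-zero w (a ∷ P) P≡0 = begin
    intR R a * w 0 + weightedSum (w ∘ suc) P   ≈⟨ +-cong (*-congʳ (reflexive (≡.cong (intR R) (P≡0 0))))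
                                                         (weightedSum-zero (w ∘ suc) P (P≡0 ∘ suc)) ⟩
    0# * w 0 + 0#                              ≈⟨ +-identityʳ _ ⟩
    0# * w 0                                   ≈⟨ zeroˡ _ ⟩
    0#                                         ∎

  weightedSum-resp-≋ : ∀ w {P Q} → P ≋ Q → weightedSum w P ≈ weightedSum w Q
  weightedSum-resp-≋ w {[]}    {Q}     e = sym (weightedSum-zero w Q (λ k → ≡.sym (coeff-≡ e k)))
  weightedSum-resp-≋ w {a ∷ P} {[]}    e = weightedSum-zero w (a ∷ P) (coeff-≡ e)
  weightedSum-resp-≋ w {a ∷ P} {b ∷ Q} e = +-cong (*-congʳ (reflexive (≡.cong (intR R) (coeff-≡ e 0))))
    (weightedSum-resp-≋ (w ∘ suc) {P} {Q} (coeffwise (coeff-≡ e ∘ suc)))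

  weightedSum-shiftBy : ∀ w s P → weightedSum w (shiftBy s P) ≈ weightedSum (λ j → w (s ℕ.+ j)) P
  weightedSum-shiftBy w zero    P = refl
  weightedSum-shiftBy w (suc s) P = begin
    0# * w 0 + weightedSum (w ∘ suc) (shiftBy s P)   ≈⟨ +-congʳ (zeroˡ (w 0)) ⟩
    0# + weightedSum (w ∘ suc) (shiftBy s P)         ≈⟨ +-identityˡ _ ⟩
    weightedSum (w ∘ suc) (shiftBy s P)              ≈⟨ weightedSum-shiftBy (w ∘ suc) s P ⟩
    weightedSum (λ j → w (suc s ℕ.+ j)) P            ∎

  weightedSum-weightFrom : ∀ w m P → weightedSum w (weightFrom m P) ≈ weightedSum (λ j → natR R (m ℕ.+ j) * w j) P
  weightedSum-weightFrom w m []      = refl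
  weightedSum-weightFrom w m (a ∷ P) = +-cong head (trans (weightedSum-weightFrom (w ∘ suc) (suc m) P) tail)
    where
    head : intR R (+ m ℤ.* a) * w 0 ≈ intR R a * (natR R (m ℕ.+ 0) * w 0)
    head = begin
      intR R (+ m ℤ.* a) * w 0          ≈⟨ *-congʳ (trans (intR-* (+ m) a) (*-comm _ _)) ⟩
      (intR R a * natR R m) * w 0       ≈⟨ *-assoc _ _ _ ⟩
      intR R a * (natR R m * w 0)       ≡⟨ ≡.cong (λ u → intR R a * (natR R u * w 0)) (ℕₚ.+-identityʳ m) ⟨
      intR R a * (natR R (m ℕ.+ 0) * w 0) ∎
    tail : weightedSum (λ j → natR R (suc m ℕ.+ j) * w (suc j)) P ≈ weightedSum (λ j → natR R (m ℕ.+ suc j) * w (suc j)) P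
    tail = weightedSum-cong (λ j → reflexive (≡.cong (λ u → natR R u * w (suc j)) (≡.sym (ℕₚ.+-suc m j)))) P

  eulerWeight : ℕ → Carrier → ℕ → Carrier
  eulerWeight ν ζ j = natR R (j ℕ.^ ν) * powR R ζ j

  derivWeight : ℕ → Carrier → ℕ → Carrier
  derivWeight ν ζ j = natR R (fall j ν) * powR R ζ (j ∸ ν)

  qdqEval≈weightedSum : ∀ ν ζ P → qdqEval R ν ζ P ≈ weightedSum (eulerWeight ν ζ) P
  qdqEval≈weightedSum ν ζ = sumCoeffs≈weightedSum _ (eulerWeight ν ζ) (λ k a → *-assoc _ _ _) 0

  derivEval≈weightedSum : ∀ ν ζ P → derivEval R ν ζ P ≈ weightedSum (derivWeight ν ζ) P
  derivEval≈weightedSum ν ζ = sumCoeffs≈weightedSum _ (derivWeight ν ζ) (λ k a → *-assoc _ _ _) 0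

  hurwitzCoeff≈qdqEval : ∀ ζ ν P → hurwitzCoeff R ζ P ν ≈ powR R (- 1#) ν * qdqEval R ν ζ P
  hurwitzCoeff≈qdqEval ζ ν P = begin
    hurwitzCoeff R ζ P ν
      ≈⟨ sumCoeffs≈weightedSum _ (λ k → powR R (- 1#) ν * eulerWeight ν ζ k)
                               (λ k a → trans (*-assoc _ _ _) (*-congˡ (term k))) 0 P ⟩
    weightedSum (λ k → powR R (- 1#) ν * eulerWeight ν ζ k) P
      ≈⟨ weightedSum-*ˡ (powR R (- 1#) ν) (eulerWeight ν ζ) P ⟩
    powR R (- 1#) ν * weightedSum (eulerWeight ν ζ) P
      ≈⟨ *-congˡ (qdqEval≈weightedSum ν ζ P) ⟨
    powR R (- 1#) ν * qdqEval R ν ζ P ∎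
    where
    term : ∀ k → powR R ζ k * intR R ((ℤ.- (+ k)) ℤ.^ ν) ≈ powR R (- 1#) ν * eulerWeight ν ζ k
    term k = begin
      powR R ζ k * intR R ((ℤ.- (+ k)) ℤ.^ ν)                ≈⟨ *-congˡ (trans (intR-^ (ℤ.- (+ k)) ν) (powR-cong (intR-neg (+ k)) ν)) ⟩
      powR R ζ k * powR R (- natR R k) ν                     ≈⟨ *-congˡ (powR-neg (natR R k) ν) ⟩
      powR R ζ k * (powR R (- 1#) ν * powR R (natR R k) ν)   ≈⟨ *-CS.x∙yz≈y∙xz _ _ _ ⟩
      powR R (- 1#) ν * (powR R ζ k * powR R (natR R k) ν)   ≈⟨ *-congˡ (*-comm _ _) ⟩
      powR R (- 1#) ν * (powR R (natR R k) ν * powR R ζ k)   ≈⟨ *-congˡ (*-congʳ (natR-^ k ν)) ⟨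
      powR R (- 1#) ν * eulerWeight ν ζ k                    ∎

module _ {c ℓ} (M : Monoid c ℓ) (Φ : Poly → Monoid.Carrier M) where
  open Monoid M

  Fpoly-stable : (∀ P Q → Φ (P +ₚ Q) ≈ Φ P ∙ Φ Q) → ∀ N₀ → (∀ m → N₀ < m → Φ (qPoch m) ≈ ε) →
                 ∀ N → N₀ ≤ N → Φ (Fpoly N₀) ≈ Φ (Fpoly N)
  Fpoly-stable Φ-+ N₀ Φ-qPoch zero    z≤n  = refl
  Fpoly-stable Φ-+ N₀ Φ-qPoch (suc N) N₀≤1+N with ℕₚ.m≤n⇒m<n∨m≡n N₀≤1+N
  ... | inj₂ ≡.refl = refl
  ... | inj₁ N₀<1+N = trans (Fpoly-stable Φ-+ N₀ Φ-qPoch N (ℕₚ.≤-pred N₀<1+N))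
    (sym (trans (Φ-+ (Fpoly N) (qPoch (suc N))) (trans (∙-congˡ (Φ-qPoch (suc N) N₀<1+N)) (identityʳ _))))

module ZeroAt {c ℓ : Level} (R : CommutativeRing c ℓ) (ζ : CommutativeRing.Carrier R) where

  open CommutativeRing R
  open Evaluation R
  open import Data.Product using (_×_; _,_)
  open import Algebra.Properties.Ring ring using (-1*x≈-x)
  open import Relation.Binary.Reasoning.Setoid setoid

  value : Poly → Carrier
  value = weightedSum (powR R ζ)

  value-shiftBy : ∀ s P → value (shiftBy s P) ≈ powR R ζ s * value P
  value-shiftBy s P = begin
    value (shiftBy s P)                               ≈⟨ weightedSum-shiftBy (powR R ζ) s P ⟩
    weightedSum (λ j → powR R ζ (s ℕ.+ j)) P          ≈⟨ weightedSum-cong (powR-+ ζ s) P ⟩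
    weightedSum (λ j → powR R ζ s * powR R ζ j) P     ≈⟨ weightedSum-*ˡ (powR R ζ s) (powR R ζ) P ⟩
    powR R ζ s * value P                              ∎

  HasZeroOfOrder : ℕ → Poly → Set ℓ
  HasZeroOfOrder zero    P = ⊤
  HasZeroOfOrder (suc a) P = value P ≈ 0# × HasZeroOfOrder a (deriv P)

  HasZeroOfOrder-resp-≋ : ∀ a {P Q} → P ≋ Q → HasZeroOfOrder a P → HasZeroOfOrder a Q
  HasZeroOfOrder-resp-≋ zero    P≋Q _          = tt
  HasZeroOfOrder-resp-≋ (suc a) P≋Q (P≈0 , P′) =
    trans (sym (weightedSum-resp-≋ (powR R ζ) P≋Q)) P≈0 , HasZeroOfOrder-resp-≋ a (deriv-cong P≋Q) P′

  HasZeroOfOrder-+ₚ : ∀ a {P Q} → HasZeroOfOrder a P → HasZeroOfOrder a Q → HasZeroOfOrder a (P +ₚ Q)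
  HasZeroOfOrder-+ₚ zero    _          _          = tt
  HasZeroOfOrder-+ₚ (suc a) {P} {Q} (P≈0 , P′) (Q≈0 , Q′) =
    trans (weightedSum-+ₚ (powR R ζ) P Q) (trans (+-cong P≈0 Q≈0) (+-identityʳ 0#)) ,
    HasZeroOfOrder-resp-≋ a (≋-sym (deriv-+ₚ P Q)) (HasZeroOfOrder-+ₚ a P′ Q′)

  HasZeroOfOrder-scale : ∀ a c {P} → HasZeroOfOrder a P → HasZeroOfOrder a (scale c P)
  HasZeroOfOrder-scale zero    c _          = tt
  HasZeroOfOrder-scale (suc a) c {P} (P≈0 , P′) =
    trans (weightedSum-scale (powR R ζ) c P) (trans (*-congˡ P≈0) (zeroʳ _)) ,
    HasZeroOfOrder-resp-≋ a (≋-sym (deriv-scale c P)) (HasZeroOfOrder-scale a c P′)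

  HasZeroOfOrder-pred : ∀ a {P} → HasZeroOfOrder (suc a) P → HasZeroOfOrder a P
  HasZeroOfOrder-pred zero    _          = tt
  HasZeroOfOrder-pred (suc a) (P≈0 , P′) = P≈0 , HasZeroOfOrder-pred a P′

  HasZeroOfOrder-shift : ∀ a {P} → HasZeroOfOrder a P → HasZeroOfOrder a (shift P)
  HasZeroOfOrder-shift zero    _          = tt
  HasZeroOfOrder-shift (suc a) {P} (P≈0 , P′) =
    trans (value-shiftBy 1 P) (trans (*-congˡ P≈0) (zeroʳ _)) ,
    HasZeroOfOrder-resp-≋ a (≋-sym (deriv-shift P))
      (HasZeroOfOrder-+ₚ a (HasZeroOfOrder-pred a (P≈0 , P′)) (HasZeroOfOrder-shift a P′))

  HasZeroOfOrder-shiftBy : ∀ a s {P} → HasZeroOfOrder a P → HasZeroOfOrder a (shiftBy s P)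
  HasZeroOfOrder-shiftBy a zero    P₀ = P₀
  HasZeroOfOrder-shiftBy a (suc s) P₀ = HasZeroOfOrder-shift a (HasZeroOfOrder-shiftBy a s P₀)

  HasZeroOfOrder-*-oneMinusQPow : ∀ a m {P} → HasZeroOfOrder a P → HasZeroOfOrder a (P *ₚ oneMinusQPow (suc m))
  HasZeroOfOrder-*-oneMinusQPow a m {P} P₀ = HasZeroOfOrder-resp-≋ a (≋-sym (*ₚ-oneMinusQPow P m))
    (HasZeroOfOrder-+ₚ a P₀ (HasZeroOfOrder-shiftBy a (suc m) (HasZeroOfOrder-scale a -1ℤ P₀)))

  value-minus-shiftBy : ∀ s P → powR R ζ s ≈ 1# → value (P +ₚ shiftBy s (scale -1ℤ P)) ≈ 0#
  value-minus-shiftBy s P ζˢ≈1 = begin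
    value (P +ₚ shiftBy s (scale -1ℤ P))          ≈⟨ weightedSum-+ₚ (powR R ζ) P _ ⟩
    value P + value (shiftBy s (scale -1ℤ P))     ≈⟨ +-congˡ (value-shiftBy s (scale -1ℤ P)) ⟩
    value P + powR R ζ s * value (scale -1ℤ P)    ≈⟨ +-congˡ (*-cong ζˢ≈1 (weightedSum-scale (powR R ζ) -1ℤ P)) ⟩
    value P + 1# * (- (1# + 0#) * value P)        ≈⟨ +-congˡ (trans (*-identityˡ _) (*-congʳ (-‿cong (+-identityʳ 1#)))) ⟩
    value P + - 1# * value P                      ≈⟨ +-congˡ (-1*x≈-x _) ⟩
    value P + - value P                           ≈⟨ -‿inverseʳ _ ⟩
    0#                                            ∎

  -- Leibniz: (P − q^s P)′ = (P′ − q^s P′) − s q^(s−1) P; the bracket gains an order by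
  -- induction on a, and the last term keeps order a.
  HasZeroOfOrder-gain : ∀ j → powR R ζ (suc j) ≈ 1# → ∀ a {P} → HasZeroOfOrder a P →
                        HasZeroOfOrder (suc a) (P +ₚ shiftBy (suc j) (scale -1ℤ P))
  HasZeroOfOrder-gain j ζˢ≈1 a {P} P₀ =
    value-minus-shiftBy (suc j) P ζˢ≈1 ,
    HasZeroOfOrder-resp-≋ a (≋-sym (deriv-+-shiftBy-scale j -1ℤ P))
      (HasZeroOfOrder-+ₚ a (gain-deriv a P₀)
        (HasZeroOfOrder-scale a (+ suc j) (HasZeroOfOrder-shiftBy a j (HasZeroOfOrder-scale a -1ℤ P₀))))
    where
    s = suc j
    gain-deriv : ∀ a → HasZeroOfOrder a P → HasZeroOfOrder a (deriv P +ₚ shiftBy s (scale -1ℤ (deriv P)))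
    gain-deriv zero    _         = tt
    gain-deriv (suc a) (_ , P′) = HasZeroOfOrder-gain j ζˢ≈1 a P′

  HasEulerZeroOfOrder : ℕ → Poly → Set ℓ
  HasEulerZeroOfOrder zero    P = ⊤
  HasEulerZeroOfOrder (suc a) P = value P ≈ 0# × HasEulerZeroOfOrder a (euler P)

  HasZeroOfOrder⇒HasEulerZeroOfOrder : ∀ a {P} → HasZeroOfOrder a P → HasEulerZeroOfOrder a P
  HasZeroOfOrder⇒HasEulerZeroOfOrder zero    _          = tt
  HasZeroOfOrder⇒HasEulerZeroOfOrder (suc a) {P} (P≈0 , P′) = P≈0 ,
    HasZeroOfOrder⇒HasEulerZeroOfOrder a
      (HasZeroOfOrder-resp-≋ a (≋-sym (euler≋shift∘deriv P)) (HasZeroOfOrder-shift a P′))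

  weight₀≈powR : ∀ j → (1# + 0#) * powR R ζ j ≈ powR R ζ j
  weight₀≈powR j = trans (*-congʳ (+-identityʳ 1#)) (*-identityˡ _)

  eulerWeight-vanishes : ∀ ν P → HasEulerZeroOfOrder (suc ν) P → weightedSum (eulerWeight ν ζ) P ≈ 0#
  eulerWeight-vanishes zero    P (P≈0 , _) = trans (weightedSum-cong weight₀≈powR P) P≈0
  eulerWeight-vanishes (suc ν) P (_ , P′)  = begin
    weightedSum (eulerWeight (suc ν) ζ) P                      ≈⟨ weightedSum-cong step P ⟩
    weightedSum (λ j → natR R (0 ℕ.+ j) * eulerWeight ν ζ j) P ≈⟨ weightedSum-weightFrom (eulerWeight ν ζ) 0 P ⟨
    weightedSum (eulerWeight ν ζ) (euler P)                    ≈⟨ eulerWeight-vanishes ν (euler P) P′ ⟩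
    0#                                                         ∎
    where
    step : ∀ j → eulerWeight (suc ν) ζ j ≈ natR R j * eulerWeight ν ζ j
    step j = trans (*-congʳ (natR-* j (j ℕ.^ ν))) (*-assoc _ _ _)

  derivWeight-suc : ∀ ν P → weightedSum (derivWeight (suc ν) ζ) P ≈ weightedSum (derivWeight ν ζ) (deriv P)
  derivWeight-suc ν []      = refl
  derivWeight-suc ν (a ∷ P) = begin
    intR R a * derivWeight (suc ν) ζ 0 + weightedSum (derivWeight (suc ν) ζ ∘ suc) P
      ≈⟨ +-congʳ (trans (*-congˡ (trans (*-congʳ fall0≈0) (zeroˡ _))) (zeroʳ _)) ⟩
    0# + weightedSum (derivWeight (suc ν) ζ ∘ suc) P
      ≈⟨ +-identityˡ _ ⟩
    weightedSum (derivWeight (suc ν) ζ ∘ suc) P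
      ≈⟨ weightedSum-cong step P ⟩
    weightedSum (λ j → natR R (1 ℕ.+ j) * derivWeight ν ζ j) P
      ≈⟨ weightedSum-weightFrom (derivWeight ν ζ) 1 P ⟨
    weightedSum (derivWeight ν ζ) (deriv (a ∷ P)) ∎
    where
    fall0≈0 : natR R (fall 0 (suc ν)) ≈ 0#
    fall0≈0 = reflexive (≡.cong (λ u → natR R (u ℕ.* fall 0 ν)) (ℕₚ.0∸n≡0 ν))
    step : ∀ j → derivWeight (suc ν) ζ (suc j) ≈ natR R (suc j) * derivWeight ν ζ j
    step j = trans (*-congʳ (trans (reflexive (≡.cong (natR R) (fall-suc j ν))) (natR-* (suc j) (fall j ν)))) (*-assoc _ _ _)

  derivWeight-vanishes : ∀ ν P → HasZeroOfOrder (suc ν) P → weightedSum (derivWeight ν ζ) P ≈ 0#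
  derivWeight-vanishes zero    P (P≈0 , _) = trans (weightedSum-cong weight₀≈powR P) P≈0
  derivWeight-vanishes (suc ν) P (_ , P′)  = trans (derivWeight-suc ν P) (derivWeight-vanishes ν (deriv P) P′)

  DissectionsHaveZeroOfOrder : (t : ℕ) .{{_ : NonZero t}} → ℕ → Poly → Set ℓ
  DissectionsHaveZeroOfOrder t a P = ∀ i → i < t → HasZeroOfOrder a (dissect t i P)

  Dissections-shift : ∀ t .{{_ : NonZero t}} a {P} → DissectionsHaveZeroOfOrder t a P →
                      DissectionsHaveZeroOfOrder t a (shift P)
  Dissections-shift (suc t) a {P} D zero    _           =
    HasZeroOfOrder-resp-≋ a (≋-sym (dissect-shift-zero t P)) (HasZeroOfOrder-shift a (D t (ℕₚ.n<1+n t)))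
  Dissections-shift (suc t) a {P} D (suc i) (s≤s i<t) =
    HasZeroOfOrder-resp-≋ a (≋-sym (dissect-shift-suc (suc t) i P)) (D i (ℕₚ.m<n⇒m<1+n i<t))

  module _ (t : ℕ) .{{_ : NonZero t}} (a : ℕ) where

    Dissections-resp-≋ : ∀ {P Q} → P ≋ Q → DissectionsHaveZeroOfOrder t a P → DissectionsHaveZeroOfOrder t a Q
    Dissections-resp-≋ P≋Q D i i<t = HasZeroOfOrder-resp-≋ a (dissect-cong t i P≋Q) (D i i<t)

    Dissections-+ₚ : ∀ {P Q} → DissectionsHaveZeroOfOrder t a P → DissectionsHaveZeroOfOrder t a Q →
                     DissectionsHaveZeroOfOrder t a (P +ₚ Q)
    Dissections-+ₚ {P} {Q} DP DQ i i<t =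
      HasZeroOfOrder-resp-≋ a (≋-sym (dissect-+ₚ t i P Q)) (HasZeroOfOrder-+ₚ a (DP i i<t) (DQ i i<t))

    Dissections-scale : ∀ c {P} → DissectionsHaveZeroOfOrder t a P → DissectionsHaveZeroOfOrder t a (scale c P)
    Dissections-scale c {P} D i i<t =
      HasZeroOfOrder-resp-≋ a (≋-sym (dissect-scale t i c P)) (HasZeroOfOrder-scale a c (D i i<t))

    Dissections-shiftBy : ∀ s {P} → DissectionsHaveZeroOfOrder t a P → DissectionsHaveZeroOfOrder t a (shiftBy s P)
    Dissections-shiftBy zero    D = D
    Dissections-shiftBy (suc s) D = Dissections-shift t a (Dissections-shiftBy s D)

    Dissections-*-oneMinusQPow : ∀ m {P} → DissectionsHaveZeroOfOrder t a P →
                                 DissectionsHaveZeroOfOrder t a (P *ₚ oneMinusQPow (suc m))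
    Dissections-*-oneMinusQPow m {P} D = Dissections-resp-≋ (≋-sym (*ₚ-oneMinusQPow P m))
      (Dissections-+ₚ {P} D (Dissections-shiftBy (suc m) (Dissections-scale -1ℤ {P} D)))

    Dissections-gain : ∀ j → powR R ζ (suc j) ≈ 1# → ∀ {P} → DissectionsHaveZeroOfOrder t a P →
                       DissectionsHaveZeroOfOrder t (suc a) (P +ₚ shiftBy (t ℕ.* suc j) (scale -1ℤ P))
    Dissections-gain j ζˢ≈1 {P} D i i<t =
      HasZeroOfOrder-resp-≋ (suc a) (≋-sym dissect-split) (HasZeroOfOrder-gain j ζˢ≈1 a (D i i<t))
      where
      dissect-split : dissect t i (P +ₚ shiftBy (t ℕ.* suc j) (scale -1ℤ P))
                  ≋ dissect t i P +ₚ shiftBy (suc j) (scale -1ℤ (dissect t i P))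
      dissect-split = ≋-trans (dissect-+ₚ t i P _) (+ₚ-cong (≋-refl {dissect t i P})
        (≋-trans (dissect-shiftBy-multiple t i (scale -1ℤ P) i<t (suc j))
                 (shiftBy-cong (suc j) (dissect-scale t i -1ℤ P))))

  qPoch-hasZeroOfOrder : ∀ n .{{_ : NonZero n}} → powR R ζ n ≈ 1# → ∀ a m → a ℕ.* n ≤ m → HasZeroOfOrder a (qPoch m)
  qPoch-hasZeroOfOrder (suc n) ζⁿ≈1 =
    qPoch-accumulates HasZeroOfOrder n (λ _ → tt) (λ {a} → HasZeroOfOrder-*-oneMinusQPow a) gain
    where
    gain : ∀ {a} k {P} → HasZeroOfOrder a P → HasZeroOfOrder (suc a) (P *ₚ oneMinusQPow (suc k ℕ.* suc n))
    gain {a} k {P} P₀ = HasZeroOfOrder-resp-≋ (suc a) (≋-sym (*ₚ-oneMinusQPow P (n ℕ.+ k ℕ.* suc n)))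
      (HasZeroOfOrder-gain (n ℕ.+ k ℕ.* suc n) (powR-*-1 ζ (suc n) ζⁿ≈1 (suc k)) a P₀)

  qPoch-dissectionsHaveZeroOfOrder : ∀ n t .{{_ : NonZero n}} .{{_ : NonZero t}} → powR R ζ n ≈ 1# →
                                     ∀ a m → a ℕ.* n ℕ.* t ≤ m → DissectionsHaveZeroOfOrder t a (qPoch m)
  qPoch-dissectionsHaveZeroOfOrder (suc n) (suc t) ζⁿ≈1 a m anm≤m =
    qPoch-accumulates (DissectionsHaveZeroOfOrder (suc t)) (t ℕ.+ n ℕ.* suc t) (λ _ i _ → tt)
      (λ {a} → Dissections-*-oneMinusQPow (suc t) a) gain a m (≡.subst (_≤ m) (ℕₚ.*-assoc a (suc n) (suc t)) anm≤m)
    where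
    L = t ℕ.+ n ℕ.* suc t
    regroup : ∀ k n t → suc t ℕ.* (suc k ℕ.* suc n) ≡.≡ suc k ℕ.* (suc n ℕ.* suc t)
    regroup = solve-∀
    gain : ∀ {a} k {P} → DissectionsHaveZeroOfOrder (suc t) a P →
           DissectionsHaveZeroOfOrder (suc t) (suc a) (P *ₚ oneMinusQPow (suc k ℕ.* suc L))
    gain {a} k {P} D = Dissections-resp-≋ (suc t) (suc a) (≋-sym (*ₚ-oneMinusQPow P (L ℕ.+ k ℕ.* suc L)))
      (≡.subst (λ s → DissectionsHaveZeroOfOrder (suc t) (suc a) (P +ₚ shiftBy s (scale -1ℤ P)))
        (regroup k n t)
        (Dissections-gain (suc t) a (n ℕ.+ k ℕ.* suc n) (powR-*-1 ζ (suc n) ζⁿ≈1 (suc k)) {P} D))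

  qdqEval-Fpoly-stable : ∀ n .{{_ : NonZero n}} → powR R ζ n ≈ 1# → ∀ ν N → (ν ℕ.+ 1) ℕ.* n ∸ 1 ≤ N →
                         qdqEval R ν ζ (Fpoly ((ν ℕ.+ 1) ℕ.* n ∸ 1)) ≈ qdqEval R ν ζ (Fpoly N)
  qdqEval-Fpoly-stable n@(suc _) ζⁿ≈1 ν = Fpoly-stable +-monoid (qdqEval R ν ζ) additive _ vanishes
    where
    qdq≈ = qdqEval≈weightedSum ν ζ
    additive : ∀ P Q → qdqEval R ν ζ (P +ₚ Q) ≈ qdqEval R ν ζ P + qdqEval R ν ζ Q
    additive P Q = trans (qdq≈ (P +ₚ Q)) (trans (weightedSum-+ₚ _ P Q) (sym (+-cong (qdq≈ P) (qdq≈ Q))))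
    vanishes : ∀ m → (ν ℕ.+ 1) ℕ.* n ∸ 1 < m → qdqEval R ν ζ (qPoch m) ≈ 0#
    vanishes m N₀<m = trans (qdq≈ (qPoch m)) (eulerWeight-vanishes ν (qPoch m)
      (HasZeroOfOrder⇒HasEulerZeroOfOrder (suc ν) (qPoch-hasZeroOfOrder n ζⁿ≈1 (suc ν) m
        (≡.subst (λ x → x ℕ.* n ∸ 1 < m) (ℕₚ.+-comm ν 1) N₀<m))))

  derivEval-Apoly-stable : ∀ n t .{{_ : NonZero n}} .{{_ : NonZero t}} → powR R ζ n ≈ 1# →
                           ∀ ν N → (ν ℕ.+ 1) ℕ.* n ℕ.* t ∸ 1 ≤ N → ∀ i → i < t →
                           derivEval R ν ζ (Apoly t N i) ≈ derivEval R ν ζ (Apoly t ((ν ℕ.+ 1) ℕ.* n ℕ.* t ∸ 1) i)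
  -- Apoly t N i is dissect t i (Fpoly N) by definition.
  derivEval-Apoly-stable n@(suc _) t@(suc _) ζⁿ≈1 ν N N₀≤N i i<t =
    sym (Fpoly-stable +-monoid (derivEval R ν ζ ∘ dissect t i) additive _ vanishes N N₀≤N)
    where
    deriv≈ = derivEval≈weightedSum ν ζ
    additive : ∀ P Q → derivEval R ν ζ (dissect t i (P +ₚ Q))
                       ≈ derivEval R ν ζ (dissect t i P) + derivEval R ν ζ (dissect t i Q)
    additive P Q = begin
      derivEval R ν ζ (dissect t i (P +ₚ Q))                     ≈⟨ deriv≈ (dissect t i (P +ₚ Q)) ⟩
      weightedSum (derivWeight ν ζ) (dissect t i (P +ₚ Q))       ≈⟨ weightedSum-resp-≋ (derivWeight ν ζ) (dissect-+ₚ t i P Q) ⟩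
      weightedSum (derivWeight ν ζ) (dissect t i P +ₚ dissect t i Q) ≈⟨ weightedSum-+ₚ _ (dissect t i P) (dissect t i Q) ⟩
      weightedSum (derivWeight ν ζ) (dissect t i P) + weightedSum (derivWeight ν ζ) (dissect t i Q)
        ≈⟨ +-cong (deriv≈ (dissect t i P)) (deriv≈ (dissect t i Q)) ⟨
      derivEval R ν ζ (dissect t i P) + derivEval R ν ζ (dissect t i Q) ∎
    vanishes : ∀ m → (ν ℕ.+ 1) ℕ.* n ℕ.* t ∸ 1 < m → derivEval R ν ζ (dissect t i (qPoch m)) ≈ 0#
    vanishes m N₀<m = trans (deriv≈ (dissect t i (qPoch m))) (derivWeight-vanishes ν (dissect t i (qPoch m))
      (qPoch-dissectionsHaveZeroOfOrder n t ζⁿ≈1 (suc ν) m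
        (≡.subst (λ x → x ℕ.* n ℕ.* t ∸ 1 < m) (ℕₚ.+-comm ν 1) N₀<m) i i<t))

  qdqEval-isStrangeQdq : ∀ n .{{_ : NonZero n}} → powR R ζ n ≈ 1# → ∀ ν →
                         IsStrangeQdq R ζ ν (qdqEval R ν ζ (Fpoly ((ν ℕ.+ 1) ℕ.* n ∸ 1)))
  qdqEval-isStrangeQdq n ζⁿ≈1 ν = _ , λ N N₀≤N →
    trans (hurwitzCoeff≈qdqEval ζ ν (Fpoly N)) (*-congˡ (sym (qdqEval-Fpoly-stable n ζⁿ≈1 ν N N₀≤N)))

open import Data.Nat using (_+_; _*_)
open import Data.Product using (_×_; _,_)

lemma2p1 : {c ℓ : Level} (R : CommutativeRing c ℓ) (n t ν : ℕ) (ζ : CommutativeRing.Carrier R) →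
  1 ≤ n → 1 ≤ t →
  CommutativeRing._≈_ R (powR R ζ n) (CommutativeRing.1# R) →
  (IsStrangeQdq R ζ ν (qdqEval R ν ζ (Fpoly ((ν + 1) * n ∸ 1)))
    × ((N : ℕ) → (ν + 1) * n ∸ 1 ≤ N →
        CommutativeRing._≈_ R (qdqEval R ν ζ (Fpoly ((ν + 1) * n ∸ 1))) (qdqEval R ν ζ (Fpoly N))))
  × ((N : ℕ) → (ν + 1) * n * t ∸ 1 ≤ N → (i : ℕ) → i < t →
      CommutativeRing._≈_ R (derivEval R ν ζ (Apoly t N i)) (derivEval R ν ζ (Apoly t ((ν + 1) * n * t ∸ 1) i)))
lemma2p1 R n@(suc _) t@(suc _) ν ζ _ _ ζⁿ≈1 =
  (qdqEval-isStrangeQdq n ζⁿ≈1 ν , qdqEval-Fpoly-stable n ζⁿ≈1 ν) , derivEval-Apoly-stable n t ζⁿ≈1 ν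
  where open ZeroAt R ζ
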